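{- For every integer $n\ge 15$, $$n-\left\lfloor \frac{n+1}{4}\right\rfloor \le f(n).$$
   Context: All graphs are finite, simple and undirected; $\overline{G}$ denotes the complement of $G$. A minor of $G$ is a graph obtained from $G$ by a sequence of vertex deletions, edge deletions and edge contractions. $\Delta(H)$ is the maximum degree of $H$. For a positive integer $n$, $f(n)$ is the largest integer such that for every graph $G$ on $n$ vertices, $G$ or $\overline{G}$ has a minor $H$ with $\Delta(H)\ge f(n)$. -}

module Defs where

open import Data.Nat using (ℕ; zero; suc; _⊔_; _+_; _≤_)
open import Data.Bool using (Bool; true; false; not; _∧_; _∨_; T)
open import Data.Bool.Properties using (∨-comm)
open import Data.Fin using (Fin; punchIn; _≟_)
open import Data.List using (List; map; foldr; allFin)
open import Data.Nat.ListAction using (sum)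
open import Data.Product using (Σ; ∃; _×_; _,_)
open import Data.Sum using (_⊎_)
open import Relation.Nullary using (yes; no)
open import Relation.Nullary.Decidable using (⌊_⌋)
open import Relation.Binary.PropositionalEquality using (_≡_; refl; sym; cong; cong₂)

record Graph (n : ℕ) : Set where
  field
    adj    : Fin n → Fin n → Bool
    adj-sym : ∀ i j → adj i j ≡ adj j i
    adj-irr : ∀ i → adj i i ≡ false
open Graph public

_==_ : ∀ {n} → Fin n → Fin n → Bool
i == j = ⌊ i ≟ j ⌋

==-sym : ∀ {n} (i j : Fin n) → (i == j) ≡ (j == i)
==-sym i j with i ≟ j | j ≟ i
... | yes _ | yes _ = refl
... | yes p | no ¬q = Data.Empty.⊥-elim (¬q (sym p))
  where import Data.Empty
... | no ¬p | yes q = Data.Empty.⊥-elim (¬p (sym q))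
  where import Data.Empty
... | no _  | no _  = refl

==-refl : ∀ {n} (i : Fin n) → (i == i) ≡ true
==-refl i with i ≟ i
... | yes _ = refl
... | no ¬p = Data.Empty.⊥-elim (¬p refl)
  where import Data.Empty

mkGraph : ∀ {n} → (Fin n → Fin n → Bool) → Graph n
mkGraph R = record
  { adj     = λ i j → not (i == j) ∧ (R i j ∨ R j i)
  ; adj-sym = λ i j → cong₂ _∧_ (cong not (==-sym i j)) (∨-comm (R i j) (R j i))
  ; adj-irr = λ i → cong (λ b → not b ∧ (R i i ∨ R i i)) (==-refl i)
  }

complement : ∀ {n} → Graph n → Graph n
complement G = mkGraph (λ i j → not (adj G i j))

bit : Bool → ℕ
bit true  = 1
bit false = 0

degree : ∀ {n} → Graph n → Fin n → ℕ
degree {n} G v = sum (map (λ j → bit (adj G v j)) (allFin n))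

Δ : ∀ {n} → Graph n → ℕ
Δ {n} G = foldr _⊔_ 0 (map (degree G) (allFin n))

deleteVertex : ∀ {n} → Graph (suc n) → Fin (suc n) → Graph n
deleteVertex G v = mkGraph (λ i j → adj G (punchIn v i) (punchIn v j))

deleteEdge : ∀ {n} → Graph n → Fin n → Fin n → Graph n
deleteEdge G u v = mkGraph (λ i j →
  adj G i j ∧ not ((i == u ∧ j == v) ∨ (i == v ∧ j == u)))

-- contract the edge {u,v}: v is removed and merged into u
-- (the merged vertex is adjacent to all former neighbours of u and v).
contract : ∀ {n} → Graph (suc n) → Fin (suc n) → Fin (suc n) → Graph n
contract G u v = mkGraph (λ i j →
  adj G (punchIn v i) (punchIn v j)
  ∨ (punchIn v i == u ∧ adj G v (punchIn v j))
  ∨ (punchIn v j == u ∧ adj G (punchIn v i) v))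

data Minor : ∀ {n m} → Graph n → Graph m → Set where
  done  : ∀ {n} {G : Graph n} → Minor G G
  delV  : ∀ {n m} {G : Graph (suc n)} {H : Graph m} (v : Fin (suc n)) →
          Minor (deleteVertex G v) H → Minor G H
  delE  : ∀ {n m} {G : Graph n} {H : Graph m} (u v : Fin n) →
          Minor (deleteEdge G u v) H → Minor G H
  contr : ∀ {n m} {G : Graph (suc n)} {H : Graph m} (u v : Fin (suc n)) →
          T (adj G u v) → Minor (contract G u v) H → Minor G H

HasMinorWithΔ≥ : ∀ {n} → Graph n → ℕ → Set
HasMinorWithΔ≥ G k = Σ ℕ (λ m → Σ (Graph m) (λ H → Minor G H × k ≤ Δ H))

-- "k ≤ f(n)": for every graph G on n vertices, G or its complement has a
-- minor H with Δ(H) ≥ k.  (Since this property is downward closed in k,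
-- k ≤ f(n) holds iff fProperty n k holds.)
fProperty : ℕ → ℕ → Set
fProperty n k = (G : Graph n) → HasMinorWithΔ≥ G k ⊎ HasMinorWithΔ≥ (complement G) k

-- Write m = ⌊(n+1)/4⌋. Call a star S of G or of its complement (a centre adjacent to all other
-- vertices of S) cheap if |S| plus the number of vertices outside S without a neighbour in S is at
-- most m; contracting a cheap star into its centre leaves a vertex of degree at least n − m.
--
-- Fix a vertex v, let H be the colour (G or its complement) in which v has the smaller degree α and
-- H′ the other one. If α < m, {v} is cheap in H′; if an H′-neighbour w of v has at most m − 2
-- H-neighbours among those of v, {v, w} is cheap in H′. Otherwise every H′-neighbour of v has at
-- least m − 1 of them, and we grow a star around v in H greedily, always adding the unused
-- H-neighbour of v that dominates the most H′-neighbours of v not yet dominated. By double counting,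
-- a round with a candidates multiplies the number of undominated vertices by at most (a − m + 1)/a.
-- For n ≥ 31 two rounds make the star cheap (a cubic inequality), for 15 ≤ n ≤ 30 three rounds do
-- (a finite computation), except when n ∈ {17, 18} and every vertex has degree at least 8 in both
-- colours. There m = 4, and double counting the edges between the two neighbourhoods of a vertex of
-- degree 8 yields a cheap star on at most three vertices.

module Submission where

open import Defs
open import Data.Nat using (ℕ; suc; _≤_; _∸_; _/_)

open import Data.Nat.Properties hiding (_≟_)
open import Algebra.Properties.Semiring.Sum +-*-semiring
  using (sum; sum-syntax; sum-cong-≗; sum-remove; sum-replicate-zero; ∑-distrib-+; ∑-comm;
         *-distribˡ-sum)
open import Data.Bool using (Bool; true; false; not; _∧_; _∨_; T; if_then_else_)
open import Data.Bool.ListAction using (any)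
open import Data.Bool.Properties using (T?; T-≡; ∧-zeroʳ; ∧-identityʳ; ∧-comm; not-involutive)
open import Data.Empty using (⊥-elim)
open import Data.Fin using (Fin; zero; suc; punchIn; punchOut; fromℕ<; _≟_)
open import Data.Fin.Properties
  using (any?; all?; ¬∀⟶∃¬; punchInᵢ≢i; punchIn-punchOut; punchIn-injective)
open import Data.List using (List; []; _∷_; length; allFin; filter; tabulate; foldr)
open import Data.List.Extrema.Nat using (argmax; argmax-all; f[xs]≤f[argmax])
open import Data.List.Membership.Propositional using (_∈_)
open import Data.List.Membership.Propositional.Properties using (∈-allFin; ∈-filter⁺; ∈-map⁺)
open import Data.List.Properties using (map-tabulate)
open import Data.List.Relation.Unary.All as All using (All; []; _∷_)
open import Data.List.Relation.Unary.All.Properties using (all-filter; All¬⇒¬Any)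
open import Data.List.Relation.Unary.Any as Any using (here; there)
open import Data.List.Relation.Unary.Any.Properties using (any⁺; any⁻)
open import Data.Nat using (zero; _<_; _+_; _*_; _%_; _⊔_; z≤n; s≤s; _≤?_; _<?_)
import Data.Nat as ℕ
import Data.Nat.ListAction as List
open import Data.Nat.DivMod using (m*n/n≡m; /-monoˡ-≤; m/n*n≤m; m≡m%n+[m/n]*n; m%n<n)
open import Data.Nat.Tactic.RingSolver using (solve-∀)
open import Data.Product using (∃; _×_; _,_; proj₁; proj₂)
import Data.Product as Product
open import Data.Sum using (_⊎_; inj₁; inj₂; [_,_]; swap)
import Data.Sum as Sum
open import Function using (_∘_; id; Equivalence)
open import Relation.Nullary using (¬_; Dec; yes; no; ¬?)
open import Relation.Nullary.Decidable
  using (⌊_⌋; toWitness; fromWitness; _×-dec_; _⊎-dec_; _→-dec_)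
open import Relation.Binary.PropositionalEquality hiding ([_])

¬T⇒≡false : ∀ {b} → ¬ T b → b ≡ false
¬T⇒≡false {true}  ¬b = ⊥-elim (¬b _)
¬T⇒≡false {false} _  = refl

¬T⇒T-not : ∀ {b} → ¬ T b → T (not b)
¬T⇒T-not {true}  ¬b = ¬b _
¬T⇒T-not {false} _  = _

≡⇒== : ∀ {n} {i j : Fin n} → i ≡ j → T (i == j)
≡⇒== {i = i} refl = Equivalence.from T-≡ (==-refl i)

==⇒≡ : ∀ {n} {i j : Fin n} → T (i == j) → i ≡ j
==⇒≡ {i = i} {j} with i ≟ j
... | yes i≡j = λ _ → i≡j
... | no  _   = λ ()

≢⇒==-false : ∀ {n} {i j : Fin n} → i ≢ j → (i == j) ≡ false
≢⇒==-false {i = i} {j} i≢j with i ≟ j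
... | yes i≡j = ⊥-elim (i≢j i≡j)
... | no  _   = refl

infixr 7 _∩_
infixr 6 _∪_ _∖_
infix 4 _⊆_

_∩_ _∪_ _∖_ : ∀ {n} → (Fin n → Bool) → (Fin n → Bool) → Fin n → Bool
(P ∩ Q) i = P i ∧ Q i
(P ∪ Q) i = P i ∨ Q i
(P ∖ Q) i = P i ∧ not (Q i)

_⊆_ : ∀ {n} → (Fin n → Bool) → (Fin n → Bool) → Set
P ⊆ Q = ∀ {i} → T (P i) → T (Q i)

module _ {n} (P Q : Fin n → Bool) {i : Fin n} where

  ∪-introˡ : T (P i) → T ((P ∪ Q) i)
  ∪-introˡ Pi with P i
  ... | true = _

  ∪-introʳ : T (Q i) → T ((P ∪ Q) i)
  ∪-introʳ Qi with P i
  ... | true  = _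
  ... | false = Qi

  ∩-intro : T (P i) → T (Q i) → T ((P ∩ Q) i)
  ∩-intro Pi Qi with P i
  ... | true = Qi

  ∩-elimˡ : T ((P ∩ Q) i) → T (P i)
  ∩-elimˡ PQi with P i
  ... | true = _

  ∩-elimʳ : T ((P ∩ Q) i) → T (Q i)
  ∩-elimʳ PQi with P i
  ... | true = PQi

  ∖-intro : T (P i) → ¬ T (Q i) → T ((P ∖ Q) i)
  ∖-intro Pi ¬Qi with P i | Q i
  ... | true | true  = ¬Qi _
  ... | true | false = _

  ∖-elimˡ : T ((P ∖ Q) i) → T (P i)
  ∖-elimˡ P∖Qi with P i
  ... | true = _

  ∖-elimʳ : T ((P ∖ Q) i) → ¬ T (Q i)
  ∖-elimʳ P∖Qi Qi with P i | Q i
  ... | true | true = P∖Qi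

count : ∀ {n} → (Fin n → Bool) → ℕ
count {n} P = ∑[ i < n ] bit (P i)

bit-mono : ∀ {a b} → (T a → T b) → bit a ≤ bit b
bit-mono {false}        _   = z≤n
bit-mono {true} {true}  _   = ≤-refl
bit-mono {true} {false} a⇒b = ⊥-elim (a⇒b _)

∑-mono-≤ : ∀ {n} {f g : Fin n → ℕ} → (∀ i → f i ≤ g i) → sum f ≤ sum g
∑-mono-≤ {zero}  _   = z≤n
∑-mono-≤ {suc n} f≤g = +-mono-≤ (f≤g zero) (∑-mono-≤ (f≤g ∘ suc))

module _ {n : ℕ} where

  count-cong : {P Q : Fin n → Bool} → (∀ i → P i ≡ Q i) → count P ≡ count Q
  count-cong P≗Q = sum-cong-≗ (cong bit ∘ P≗Q)

  count-mono : (P Q : Fin n → Bool) → P ⊆ Q → count P ≤ count Q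
  count-mono P Q P⊆Q = ∑-mono-≤ {n} λ _ → bit-mono P⊆Q

  count-empty : count {n} (λ _ → false) ≡ 0
  count-empty = sum-replicate-zero n

  count-full : count {n} (λ _ → true) ≡ n
  count-full = ∑1≡ n
    where
    ∑1≡ : ∀ k → ∑[ i < k ] 1 ≡ k
    ∑1≡ zero    = refl
    ∑1≡ (suc k) = cong suc (∑1≡ k)

  count≤n : (P : Fin n → Bool) → count P ≤ n
  count≤n P = ≤-trans (count-mono P (λ _ → true) _) (≤-reflexive count-full)

  count-split : (P Q : Fin n → Bool) → count P ≡ count (P ∩ Q) + count (P ∖ Q)
  count-split P Q = trans (sum-cong-≗ split) (∑-distrib-+ (λ i → bit ((P ∩ Q) i)) _)
    where
    split : ∀ i → bit (P i) ≡ bit ((P ∩ Q) i) + bit ((P ∖ Q) i)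
    split i with P i | Q i
    ... | false | _     = refl
    ... | true  | true  = refl
    ... | true  | false = refl

  count-∪ : (P Q : Fin n → Bool) → count (P ∪ Q) ≤ count P + count Q
  count-∪ P Q = ≤-trans (∑-mono-≤ {n} bit-∨) (≤-reflexive (∑-distrib-+ (λ i → bit (P i)) _))
    where
    bit-∨ : ∀ i → bit ((P ∪ Q) i) ≤ bit (P i) + bit (Q i)
    bit-∨ i with P i | Q i
    ... | false | _ = ≤-refl
    ... | true  | _ = s≤s z≤n

  count>0⇒nonempty : (P : Fin n → Bool) → 0 < count P → ∃ λ v → T (P v)
  count>0⇒nonempty P 0<count with any? (λ v → T? (P v))
  ... | yes nonempty = nonempty
  ... | no  empty    = ⊥-elim (<⇒≱ 0<count (≤-trans (count-mono P (λ _ → false) none)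
                                                     (≤-reflexive count-empty)))
    where
    none : P ⊆ (λ _ → false)
    none {v} Pv = empty (v , Pv)

count-singleton : ∀ {n} (v : Fin n) → count (_== v) ≡ 1
count-singleton {suc n} v = begin
  count (_== v)                                     ≡⟨ sum-remove {i = v} (λ i → bit (i == v)) ⟩
  bit (v == v) + ∑[ i < n ] bit (punchIn v i == v)  ≡⟨ cong₂ _+_ (cong bit (==-refl v)) elsewhere ⟩
  1 + count {n} (λ _ → false)                       ≡⟨ cong suc (count-empty {n}) ⟩
  1                                                 ∎
  where
  open ≡-Reasoning
  elsewhere = sum-cong-≗ λ i → cong bit (≢⇒==-false (punchInᵢ≢i v i))

count-remove : ∀ {n} (P : Fin n → Bool) {v} → T (P v) → count P ≡ suc (count (P ∖ (_== v)))
count-remove P {v} Pv = trans (count-split P (_== v)) (cong (_+ count (P ∖ (_== v))) only-v)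
  where
  at-v : ∀ i → (P ∩ (_== v)) i ≡ (i == v)
  at-v i with i ≟ v
  ... | no  _    = ∧-zeroʳ (P i)
  ... | yes refl = trans (∧-identityʳ (P v)) (Equivalence.to T-≡ Pv)
  only-v : count (P ∩ (_== v)) ≡ 1
  only-v = trans (count-cong at-v) (count-singleton v)

sumOver : ∀ {n} → (Fin n → Bool) → (Fin n → ℕ) → ℕ
sumOver {n} A f = ∑[ i < n ] (if A i then f i else 0)

syntax sumOver A (λ a → x) = ∑[ a ∈ A ] x

module _ {n} (A : Fin n → Bool) (f : Fin n → ℕ) where

  c*count≤∑∈ : ∀ c → (∀ {a} → T (A a) → c ≤ f a) → c * count A ≤ ∑[ a ∈ A ] f a
  c*count≤∑∈ c c≤f = begin
    c * count A                ≡⟨ *-distribˡ-sum c (λ i → bit (A i)) ⟩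
    ∑[ i < n ] (c * bit (A i)) ≤⟨ ∑-mono-≤ {n} pointwise ⟩
    ∑[ a ∈ A ] f a             ∎
    where
    open ≤-Reasoning
    pointwise : ∀ i → c * bit (A i) ≤ (if A i then f i else 0)
    pointwise i with A i in eq
    ... | true  = ≤-trans (≤-reflexive (*-identityʳ c)) (c≤f (Equivalence.from T-≡ eq))
    ... | false = ≤-reflexive (*-zeroʳ c)

  ∑∈≤c*count : ∀ c → (∀ {a} → T (A a) → f a ≤ c) → ∑[ a ∈ A ] f a ≤ c * count A
  ∑∈≤c*count c f≤c = begin
    ∑[ a ∈ A ] f a             ≤⟨ ∑-mono-≤ {n} pointwise ⟩
    ∑[ i < n ] (c * bit (A i)) ≡⟨ *-distribˡ-sum c (λ i → bit (A i)) ⟨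
    c * count A                ∎
    where
    open ≤-Reasoning
    pointwise : ∀ i → (if A i then f i else 0) ≤ c * bit (A i)
    pointwise i with A i in eq
    ... | true  = ≤-trans (f≤c (Equivalence.from T-≡ eq)) (≤-reflexive (sym (*-identityʳ c)))
    ... | false = z≤n

  maximiser : ∀ {t₀} → T (A t₀) → ∃ λ t → T (A t) × (∀ {s} → T (A s) → f s ≤ f t)
  maximiser {t₀} At₀ =
    argmax f t₀ xs ,
    argmax-all f At₀ (all-filter (T? ∘ A) (allFin n)) ,
    λ As → All.lookup (f[xs]≤f[argmax] t₀ xs) (∈-filter⁺ (T? ∘ A) (∈-allFin _) As)
    where xs = filter (T? ∘ A) (allFin n)

  ∃-above-average : ∀ {t₀} → T (A t₀) → ∃ λ t → T (A t) × ∑[ a ∈ A ] f a ≤ count A * f t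
  ∃-above-average At₀ =
    let t , At , max = maximiser At₀
    in  t , At , ≤-trans (∑∈≤c*count (f t) max) (≤-reflexive (*-comm (f t) (count A)))

∑∈-count-comm : ∀ {n} (A B : Fin n → Bool) (F : Fin n → Fin n → Bool) → (∀ a b → F a b ≡ F b a) →
                ∑[ a ∈ A ] count (B ∩ F a) ≡ ∑[ b ∈ B ] count (A ∩ F b)
∑∈-count-comm {n} A B F F-sym = begin
  ∑[ a ∈ A ] count (B ∩ F a)                     ≡⟨ sum-cong-≗ (as-double-sum A B F) ⟩
  ∑[ a < n ] ∑[ b < n ] bit (A a ∧ B b ∧ F a b)  ≡⟨ ∑-comm (λ a b → bit (A a ∧ B b ∧ F a b)) ⟩
  ∑[ b < n ] ∑[ a < n ] bit (A a ∧ B b ∧ F a b)  ≡⟨ sum-cong-≗ (λ b → sum-cong-≗ (cong bit ∘ reorder b)) ⟩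
  ∑[ b < n ] ∑[ a < n ] bit (B b ∧ A a ∧ F b a)  ≡⟨ sum-cong-≗ (as-double-sum B A F) ⟨
  ∑[ b ∈ B ] count (A ∩ F b)                     ∎
  where
  open ≡-Reasoning
  as-double-sum : ∀ (A B : Fin n → Bool) (F : Fin n → Fin n → Bool) a →
                  (if A a then count (B ∩ F a) else 0) ≡ ∑[ b < n ] bit (A a ∧ B b ∧ F a b)
  as-double-sum A B F a with A a
  ... | true  = refl
  ... | false = sym (count-empty {n})
  reorder : ∀ b a → A a ∧ B b ∧ F a b ≡ B b ∧ A a ∧ F b a
  reorder b a rewrite F-sym a b with A a | B b
  ... | true  | true  = refl
  ... | true  | false = refl
  ... | false | true  = refl
  ... | false | false = refl

adj⇒≢ : ∀ {n} (H : Graph n) {i j} → T (adj H i j) → i ≢ j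
adj⇒≢ H {i} Hii refl = subst T (adj-irr H i) Hii

adj-symᵀ : ∀ {n} (H : Graph n) {i j} → T (adj H i j) → T (adj H j i)
adj-symᵀ H {i} {j} = subst T (adj-sym H i j)

sum-tabulate : ∀ {n} (f : Fin n → ℕ) → List.sum (tabulate f) ≡ ∑[ i < n ] f i
sum-tabulate {zero}  f = refl
sum-tabulate {suc n} f = cong (f zero +_) (sum-tabulate (f ∘ suc))

degree≡count : ∀ {n} (G : Graph n) v → degree G v ≡ count (adj G v)
degree≡count {n} G v = trans (cong List.sum (map-tabulate {n = n} id (λ j → bit (adj G v j))))
                             (sum-tabulate (λ j → bit (adj G v j)))

≤-foldr-⊔ : ∀ {x xs} → x ∈ xs → x ≤ foldr _⊔_ 0 xs
≤-foldr-⊔ (here refl)                = m≤m⊔n _ _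
≤-foldr-⊔ {xs = y ∷ _} (there x∈xs) = ≤-trans (≤-foldr-⊔ x∈xs) (m≤n⊔m y _)

count-adj≤Δ : ∀ {n} (G : Graph n) v → count (adj G v) ≤ Δ G
count-adj≤Δ G v = subst (_≤ Δ G) (degree≡count G v) (≤-foldr-⊔ (∈-map⁺ (degree G) (∈-allFin v)))

record Complementary {n} (H H′ : Graph n) : Set where
  field
    adj′≡not-adj : ∀ {i j} → i ≢ j → adj H′ i j ≡ not (adj H i j)
open Complementary public

complement-complementary : ∀ {n} (G : Graph n) → Complementary G (complement G)
complement-complementary G .adj′≡not-adj {i} {j} i≢j
  rewrite ≢⇒==-false i≢j | adj-sym G j i with adj G i j
... | true  = refl
... | false = refl

complementary-sym : ∀ {n} {H H′ : Graph n} → Complementary H H′ → Complementary H′ H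
complementary-sym {H = H} compl .adj′≡not-adj {i} {j} i≢j =
  trans (sym (not-involutive (adj H i j))) (cong not (sym (compl .adj′≡not-adj i≢j)))

module _ {n} {H H′ : Graph n} (compl : Complementary H H′) where

  non-adj⇒adj′ : ∀ {i j} → i ≢ j → ¬ T (adj H i j) → T (adj H′ i j)
  non-adj⇒adj′ i≢j ¬Hij rewrite compl .adj′≡not-adj i≢j = ¬T⇒T-not ¬Hij

  adj⇒non-adj′ : ∀ {i j} → T (adj H i j) → ¬ T (adj H′ i j)
  adj⇒non-adj′ Hij rewrite compl .adj′≡not-adj (adj⇒≢ H Hij) | Equivalence.to T-≡ Hij = λ ()

  count-split-nonmember : (P : Fin n → Bool) {b : Fin n} → ¬ T (P b) →
                          count P ≡ count (P ∩ adj H b) + count (P ∩ adj H′ b)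
  count-split-nonmember P {b} ¬Pb =
    trans (count-split P (adj H b)) (cong (count (P ∩ adj H b) +_) (count-cong other-side))
    where
    other-side : ∀ z → (P ∖ adj H b) z ≡ (P ∩ adj H′ b) z
    other-side z with z ≟ b
    ... | yes refl rewrite ¬T⇒≡false ¬Pb = refl
    ... | no  z≢b  rewrite compl .adj′≡not-adj (z≢b ∘ sym) = refl

  count-split-member : (P : Fin n → Bool) {b : Fin n} → T (P b) →
                       count P ≡ suc (count (P ∩ adj H b) + count (P ∩ adj H′ b))
  count-split-member P {b} Pb = begin
    count P                                                   ≡⟨ count-remove P Pb ⟩
    suc (count P-b)                                           ≡⟨ cong suc (count-split-nonmember P-b b∉) ⟩
    suc (count (P-b ∩ adj H b) + count (P-b ∩ adj H′ b))      ≡⟨ cong suc (cong₂ _+_ (count-cong (drop-b H))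
                                                                                     (count-cong (drop-b H′))) ⟩
    suc (count (P ∩ adj H b) + count (P ∩ adj H′ b))          ∎
    where
    open ≡-Reasoning
    P-b = P ∖ (_== b)
    b∉ : ¬ T (P-b b)
    b∉ P-b∋b = ∖-elimʳ P (_== b) P-b∋b (≡⇒== refl)
    drop-b : ∀ F z → (P-b ∩ adj F b) z ≡ (P ∩ adj F b) z
    drop-b F z with z ≟ b
    ... | yes refl rewrite adj-irr F z = trans (∧-zeroʳ _) (sym (∧-zeroʳ _))
    ... | no  _    = cong (_∧ adj F b z) (∧-identityʳ (P z))

  degree-sum : ∀ v → suc (count (adj H v) + count (adj H′ v)) ≡ n
  degree-sum v = trans (sym (count-split-member (λ _ → true) _)) count-full

contract-inherits : ∀ {n} (H : Graph (suc n)) u v {i j} →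
                    T (adj H (punchIn v i) (punchIn v j)) → T (adj (contract H u v) i j)
contract-inherits H u v Hij
  rewrite ≢⇒==-false (adj⇒≢ H Hij ∘ cong (punchIn v)) | Equivalence.to T-≡ Hij = _

contract-merges : ∀ {n} (H : Graph (suc n)) u v {i j} → punchIn v i ≡ u → i ≢ j →
                  T (adj H v (punchIn v j)) → T (adj (contract H u v) i j)
contract-merges H u v {i} {j} i↦u i≢j Hvj
  rewrite ≢⇒==-false i≢j | Equivalence.to T-≡ (≡⇒== i↦u) | Equivalence.to T-≡ Hvj
  with adj H (punchIn v i) (punchIn v j)
... | true  = _
... | false = _

InBoundary : ∀ {n} → Graph n → (Fin n → Bool) → Fin n → Set
InBoundary H S w = ¬ T (S w) × ∃ λ s → T (S s) × T (adj H s w)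

inBoundary? : ∀ {n} (H : Graph n) S w → Dec (InBoundary H S w)
inBoundary? H S w = ¬? (T? (S w)) ×-dec any? (λ s → T? (S s) ×-dec T? (adj H s w))

boundary : ∀ {n} → Graph n → (Fin n → Bool) → Fin n → Bool
boundary H S w = ⌊ inBoundary? H S w ⌋

∈⇒∉boundary : ∀ {n} (H : Graph n) S {w} → T (S w) → boundary H S w ≡ false
∈⇒∉boundary H S {w} Sw = ¬T⇒≡false (λ ∂w → proj₁ (toWitness {a? = inBoundary? H S w} ∂w) Sw)

IsStar : ∀ {n} → Graph n → (Fin n → Bool) → Fin n → Set
IsStar H S c = T (S c) × (∀ {s} → T (S s) → s ≢ c → T (adj H c s))

module ContractLeaf {n} (H : Graph (suc n)) (S : Fin (suc n) → Bool) {c} (star : IsStar H S c)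
                    {v} (Sv : T (S v)) (v≢c : v ≢ c) where

  H′ : Graph n
  H′ = contract H c v

  S′ : Fin n → Bool
  S′ = S ∘ punchIn v

  c′ : Fin n
  c′ = punchOut v≢c

  c′↦c : punchIn v c′ ≡ c
  c′↦c = punchIn-punchOut v≢c

  star′ : IsStar H′ S′ c′
  star′ = subst (T ∘ S) (sym c′↦c) (proj₁ star) , spoke
    where
    spoke : ∀ {s} → T (S′ s) → s ≢ c′ → T (adj H′ c′ s)
    spoke {s} Ss s≢c′ = contract-inherits H c v
      (subst (λ x → T (adj H x (punchIn v s))) (sym c′↦c)
        (proj₂ star Ss (λ s↦c → s≢c′ (punchIn-injective v s c′ (trans s↦c (sym c′↦c))))))

  boundary-grows : count (boundary H S) ≤ count (boundary H′ S′)
  boundary-grows = begin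
    count (boundary H S)                                     ≡⟨ sum-remove {i = v} (bit ∘ boundary H S) ⟩
    bit (boundary H S v) + count ∂′                          ≡⟨ cong (λ b → bit b + count ∂′) (∈⇒∉boundary H S Sv) ⟩
    count ∂′                                                 ≤⟨ count-mono ∂′ (boundary H′ S′)
                                                                    (fromWitness ∘ keeps ∘ toWitness) ⟩
    count (boundary H′ S′)                                   ∎
    where
    open ≤-Reasoning
    ∂′ = boundary H S ∘ punchIn v
    keeps : ∀ {w} → InBoundary H S (punchIn v w) → InBoundary H′ S′ w
    keeps {w} (S∌w , s , Ss , Hsw) with s ≟ v
    ... | yes refl = S∌w , c′ , proj₁ star′ , contract-merges H c v c′↦c c′≢w Hsw
      where
      c′≢w : c′ ≢ w
      c′≢w refl = S∌w (subst (T ∘ S) (sym c′↦c) (proj₁ star))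
    ... | no  s≢v  = S∌w , s′ , subst (T ∘ S) (sym s′↦s) Ss ,
                     contract-inherits H c v (subst (λ x → T (adj H x (punchIn v w))) (sym s′↦s) Hsw)
      where
      s′ = punchOut (s≢v ∘ sym)
      s′↦s = punchIn-punchOut (s≢v ∘ sym)

star-contraction : ∀ {n} (H : Graph n) (S : Fin n → Bool) {c} → IsStar H S c →
                   HasMinorWithΔ≥ H (count (boundary H S))
star-contraction {suc n} H S {c} star with any? (λ v → T? (S v) ×-dec ¬? (v ≟ c))
... | no only-c = suc n , H , done ,
                  ≤-trans (count-mono (boundary H S) (adj H c) (inNeighbourhood ∘ toWitness)) (count-adj≤Δ H c)
  where
  inNeighbourhood : ∀ {w} → InBoundary H S w → T (adj H c w)
  inNeighbourhood (_ , s , Ss , Hsw) with s ≟ c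
  ... | yes refl = Hsw
  ... | no  s≢c  = ⊥-elim (only-c (s , Ss , s≢c))
... | yes (v , Sv , v≢c) =
  let m , H₀ , H′≽H₀ , ∂≤Δ = star-contraction H′ S′ star′
  in  m , H₀ , contr c v (proj₂ star Sv v≢c) H′≽H₀ , ≤-trans boundary-grows ∂≤Δ
  where open ContractLeaf H S star Sv v≢c

record DominatingStar {n} (H : Graph n) (m : ℕ) : Set where
  field
    centre      : Fin n
    leaves      : List (Fin n)
    spokes      : All (T ∘ adj H centre) leaves
    undominated : Fin n → Bool
    covers      : ∀ z → All (λ s → s ≢ z × ¬ T (adj H s z)) (centre ∷ leaves) → T (undominated z)
    cost        : suc (length leaves) + count undominated ≤ m

StarCover : ∀ {n} → Graph n → Graph n → ℕ → Set
StarCover H H′ m = DominatingStar H m ⊎ DominatingStar H′ m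

memberOf : ∀ {n} → List (Fin n) → Fin n → Bool
memberOf xs z = any (z ==_) xs

∈⇒memberOf : ∀ {n} {xs : List (Fin n)} {z} → z ∈ xs → T (memberOf xs z)
∈⇒memberOf {z = z} z∈xs = any⁺ (z ==_) (Any.map ≡⇒== z∈xs)

memberOf⇒∈ : ∀ {n} {xs : List (Fin n)} {z} → T (memberOf xs z) → z ∈ xs
memberOf⇒∈ {xs = xs} {z} z∈xs = Any.map ==⇒≡ (any⁻ (z ==_) xs z∈xs)

count-memberOf : ∀ {n} (xs : List (Fin n)) → count (memberOf xs) ≤ length xs
count-memberOf {n} []       = ≤-reflexive (count-empty {n})
count-memberOf     (x ∷ xs) = begin
  count ((_== x) ∪ memberOf xs)        ≤⟨ count-∪ (_== x) (memberOf xs) ⟩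
  count (_== x) + count (memberOf xs)  ≤⟨ +-mono-≤ (≤-reflexive (count-singleton x)) (count-memberOf xs) ⟩
  suc (length xs)                      ∎
  where open ≤-Reasoning

module _ {n} {H : Graph n} {m} (D : DominatingStar H m) where

  open DominatingStar D

  private
    S : Fin n → Bool
    S = memberOf (centre ∷ leaves)

  star : IsStar H S centre
  star = ∈⇒memberOf {xs = centre ∷ leaves} (here refl) , spoke ∘ memberOf⇒∈
    where
    spoke : ∀ {s} → s ∈ centre ∷ leaves → s ≢ centre → T (adj H centre s)
    spoke (here s≡c)   s≢c = ⊥-elim (s≢c s≡c)
    spoke (there s∈ls) _   = All.lookup spokes s∈ls

  partition : ∀ z → T ((S ∪ boundary H S ∪ undominated) z)
  partition z = by-cases (T? (S z)) (T? (boundary H S z))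
    where
    R = boundary H S ∪ undominated
    by-cases : Dec (T (S z)) → Dec (T (boundary H S z)) → T ((S ∪ boundary H S ∪ undominated) z)
    by-cases (yes Sz) _        = ∪-introˡ S R Sz
    by-cases (no _)   (yes ∂z) = ∪-introʳ S R (∪-introˡ (boundary H S) undominated ∂z)
    by-cases (no S∌z) (no ∂∌z) =
      ∪-introʳ S R (∪-introʳ (boundary H S) undominated (covers z (All.tabulate apart)))
      where
      apart : ∀ {s} → s ∈ centre ∷ leaves → s ≢ z × ¬ T (adj H s z)
      apart s∈S = (λ { refl → S∌z (∈⇒memberOf s∈S) })
                , (λ Hsz → ∂∌z (fromWitness (S∌z , _ , ∈⇒memberOf s∈S , Hsz)))

  dominatingStar⇒minor : HasMinorWithΔ≥ H (n ∸ m)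
  dominatingStar⇒minor =
    let k , H₀ , H≽H₀ , ∂≤Δ = star-contraction H S star
    in  k , H₀ , H≽H₀ , ≤-trans (m≤n+o⇒m∸n≤o n m n≤m+∂) ∂≤Δ
    where
    open ≤-Reasoning
    ∂ = count (boundary H S)
    n≤m+∂ : n ≤ m + ∂
    n≤m+∂ = begin
      n                                                ≡⟨ count-full ⟨
      count {n} (λ _ → true)                           ≤⟨ count-mono _ (S ∪ boundary H S ∪ undominated)
                                                                     (λ {z} _ → partition z) ⟩
      count (S ∪ boundary H S ∪ undominated)           ≤⟨ count-∪ S _ ⟩
      count S + count (boundary H S ∪ undominated)     ≤⟨ +-monoʳ-≤ (count S) (count-∪ (boundary H S) undominated) ⟩
      count S + (∂ + count undominated)                ≤⟨ +-monoˡ-≤ _ (count-memberOf (centre ∷ leaves)) ⟩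
      suc (length leaves) + (∂ + count undominated)    ≡⟨ cong (suc (length leaves) +_) (+-comm ∂ _) ⟩
      suc (length leaves) + (count undominated + ∂)    ≡⟨ +-assoc (suc (length leaves)) _ ∂ ⟨
      suc (length leaves) + count undominated + ∂      ≤⟨ +-monoˡ-≤ ∂ cost ⟩
      m + ∂                                            ∎

-- A greedy round with a candidates, each of the u undominated vertices being adjacent to at least
-- k of them, leaves at most (a − k)·u/a vertices undominated. (shrink 0 is junk: a round always
-- has a candidate.)
shrink : ℕ → ℕ → ℕ → ℕ
shrink zero        _ _ = 0
shrink a@(suc _) k u = (a ∸ k) * u / a

-- Round i (counting from 0) has α − i candidates.
greedyBound : ℕ → ℕ → ℕ → ℕ → ℕ
greedyBound k α β zero    = β
greedyBound k α β (suc i) = shrink (α ∸ i) k (greedyBound k α β i)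

-- A vertex of degrees α and β in H and H′ is settled with budget m by the star {v} or by i
-- greedy rounds.
Settled : ℕ → ℕ → ℕ → Set
Settled m α β = α < m ⊎ ∃ λ i → i + greedyBound (m ∸ 1) α β i < m

shrink-sound : ∀ {a k u u′ b} → 0 < a → a * u′ + k * u ≤ a * u → u ≤ b → u′ ≤ shrink a k b
shrink-sound {a@(suc _)} {k} {u} {u′} {b} _ round u≤b = begin
  u′            ≡⟨ m*n/n≡m u′ a ⟨
  u′ * a / a    ≤⟨ /-monoˡ-≤ a (begin
    u′ * a          ≡⟨ *-comm u′ a ⟩
    a * u′          ≤⟨ m+n≤o⇒m≤o∸n (a * u′) round ⟩
    a * u ∸ k * u   ≡⟨ *-distribʳ-∸ u a k ⟨
    (a ∸ k) * u     ≤⟨ *-monoʳ-≤ (a ∸ k) u≤b ⟩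
    (a ∸ k) * b     ∎) ⟩
  shrink a k b  ∎
  where open ≤-Reasoning

shrink-floor : ∀ a k b → a * shrink a k b ≤ (a ∸ k) * b
shrink-floor zero        k b = z≤n
shrink-floor a@(suc _) k b = begin
  a * ((a ∸ k) * b / a)  ≡⟨ *-comm a _ ⟩
  (a ∸ k) * b / a * a    ≤⟨ m/n*n≤m ((a ∸ k) * b) a ⟩
  (a ∸ k) * b            ∎
  where open ≤-Reasoning

shrink-≤ : ∀ a k b → shrink a k b ≤ b
shrink-≤ zero        k b = z≤n
shrink-≤ a@(suc _) k b = begin
  (a ∸ k) * b / a  ≤⟨ /-monoˡ-≤ a (*-monoˡ-≤ b (m∸n≤m a k)) ⟩
  a * b / a        ≡⟨ cong (_/ a) (*-comm a b) ⟩
  b * a / a        ≡⟨ m*n/n≡m b a ⟩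
  b                ∎
  where open ≤-Reasoning

two-rounds-bound : ∀ k j β → let α = suc (k + j) in α * α * greedyBound k α β 2 ≤ suc j * suc j * β
two-rounds-bound k j β = begin
  α * α * u₂           ≡⟨ *-assoc α α u₂ ⟩
  α * (α * u₂)         ≤⟨ *-monoʳ-≤ α round₂ ⟩
  α * (suc j * u₁)     ≡⟨ x*[y*z]≡y*[x*z] α (suc j) u₁ ⟩
  suc j * (α * u₁)     ≤⟨ *-monoʳ-≤ (suc j) round₁ ⟩
  suc j * (suc j * β)  ≡⟨ *-assoc (suc j) (suc j) β ⟨
  suc j * suc j * β    ∎
  where
  open ≤-Reasoning
  α = suc (k + j)
  u₁ = shrink α k β
  u₂ = shrink (k + j) k u₁
  x*[y*z]≡y*[x*z] : ∀ x y z → x * (y * z) ≡ y * (x * z)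
  x*[y*z]≡y*[x*z] x y z = trans (sym (*-assoc x y z)) (trans (cong (_* z) (*-comm x y)) (*-assoc y x z))
  α∸k≡1+j : α ∸ k ≡ suc j
  α∸k≡1+j = trans (cong (_∸ k) (sym (+-suc k j))) (m+n∸m≡n k (suc j))
  round₁ : α * u₁ ≤ suc j * β
  round₁ = ≤-trans (shrink-floor α k β) (≤-reflexive (cong (_* β) α∸k≡1+j))
  round₂ : α * u₂ ≤ suc j * u₁
  round₂ = +-mono-≤ (shrink-≤ (k + j) k u₁)
                    (≤-trans (shrink-floor (k + j) k u₁) (≤-reflexive (cong (_* u₁) (m+n∸m≡n k j))))

module AtVertex {n} {H H′ : Graph n} (compl : Complementary H H′) (m : ℕ) (v : Fin n) where

  K L : Fin n → Bool
  K = adj H v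
  L = adj H′ v

  private
    compl′ : Complementary H′ H
    compl′ = complementary-sym compl

  single-star : suc (count K) ≤ m → DominatingStar H′ m
  single-star cost = record
    { centre = v ; leaves = [] ; spokes = [] ; undominated = K
    ; covers = λ { z ((v≢z , ¬H′vz) ∷ []) → non-adj⇒adj′ compl′ v≢z ¬H′vz }
    ; cost = cost }

  pair-star : ∀ {w} → T (L w) → 2 + count (K ∩ adj H w) ≤ m → DominatingStar H′ m
  pair-star {w} Lw cost = record
    { centre = v ; leaves = w ∷ [] ; spokes = Lw ∷ [] ; undominated = K ∩ adj H w
    ; covers = λ { z ((v≢z , ¬H′vz) ∷ (w≢z , ¬H′wz) ∷ []) →
                   ∩-intro K (adj H w) (non-adj⇒adj′ compl′ v≢z ¬H′vz) (non-adj⇒adj′ compl′ w≢z ¬H′wz) }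
    ; cost = cost }

  dominatedBy : List (Fin n) → Fin n → Bool
  dominatedBy ts z = any (λ t → adj H t z) ts

  uncovered unused : List (Fin n) → Fin n → Bool
  uncovered ts = L ∖ dominatedBy ts
  unused    ts = K ∖ memberOf ts

  greedy-star : ∀ {ts} → All (T ∘ K) ts → suc (length ts) + count (uncovered ts) ≤ m → DominatingStar H m
  greedy-star {ts} ts⊆K cost = record
    { centre = v ; leaves = ts ; spokes = ts⊆K ; undominated = uncovered ts
    ; covers = λ { z ((v≢z , ¬Hvz) ∷ apart) →
                   ∖-intro L (dominatedBy ts) (non-adj⇒adj′ compl v≢z ¬Hvz)
                                              (All¬⇒¬Any (All.map proj₂ apart) ∘ any⁻ _ ts) }
    ; cost = cost }

  ManyCommonNeighbours : Set
  ManyCommonNeighbours = ∀ {w} → T (L w) → m ∸ 1 ≤ count (K ∩ adj H w)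

  module GreedyRound (many : ManyCommonNeighbours) (2≤m : 2 ≤ m) (ts : List (Fin n))
                     (U>0 : 0 < count (uncovered ts)) where

    private
      U D : Fin n → Bool
      U = uncovered ts
      D = unused ts
      k = m ∸ 1
      hits : Fin n → ℕ
      hits t = count (U ∩ adj H t)

    neighbours-unused : ∀ {w} → T (U w) → K ∩ adj H w ⊆ D ∩ adj H w
    neighbours-unused {w} Uw {z} KHwz =
      ∩-intro D (adj H w) (∖-intro K (memberOf ts) (∩-elimˡ K (adj H w) KHwz) unchosen) Hwz
      where
      Hwz = ∩-elimʳ K (adj H w) KHwz
      unchosen : ¬ T (memberOf ts z)
      unchosen z∈ts = ∖-elimʳ L (dominatedBy ts) Uw
        (any⁺ (λ t → adj H t w) (Any.map (λ { refl → adj-symᵀ H Hwz }) (memberOf⇒∈ {xs = ts} z∈ts)))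

    incidences≥ : k * count U ≤ ∑[ t ∈ D ] hits t
    incidences≥ = begin
      k * count U                     ≤⟨ c*count≤∑∈ U (λ w → count (D ∩ adj H w)) k many-unused ⟩
      ∑[ w ∈ U ] count (D ∩ adj H w)  ≡⟨ ∑∈-count-comm U D (adj H) (adj-sym H) ⟩
      ∑[ t ∈ D ] hits t               ∎
      where
      open ≤-Reasoning
      many-unused : ∀ {w} → T (U w) → k ≤ count (D ∩ adj H w)
      many-unused {w} Uw = ≤-trans (many (∖-elimˡ L (dominatedBy ts) Uw))
                                   (count-mono (K ∩ adj H w) (D ∩ adj H w) (neighbours-unused Uw))

    unused-nonempty : 0 < count D
    unused-nonempty = n≢0⇒n>0 λ D≡0 → <⇒≱ (*-mono-≤ (∸-monoˡ-≤ 1 2≤m) U>0) (begin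
      k * count U        ≤⟨ incidences≥ ⟩
      ∑[ t ∈ D ] hits t  ≤⟨ ∑∈≤c*count D hits n (λ _ → count≤n _) ⟩
      n * count D        ≡⟨ cong (n *_) D≡0 ⟩
      n * 0              ≡⟨ *-zeroʳ n ⟩
      0                  ∎)
      where open ≤-Reasoning

    private
      best = ∃-above-average D hits (proj₂ (count>0⇒nonempty D unused-nonempty))

    t : Fin n
    t = proj₁ best

    t-unused : T (D t)
    t-unused = proj₁ (proj₂ best)

    uncovered-split : count U ≡ hits t + count (uncovered (t ∷ ts))
    uncovered-split = trans (count-split U (adj H t)) (cong (hits t +_) (count-cong not-by-t))
      where
      not-by-t : ∀ z → (U ∖ adj H t) z ≡ uncovered (t ∷ ts) z
      not-by-t z with L z | adj H t z | dominatedBy ts z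
      ... | false | _     | _     = refl
      ... | true  | true  | true  = refl
      ... | true  | true  | false = refl
      ... | true  | false | true  = refl
      ... | true  | false | false = refl

    shrinks : count D * count (uncovered (t ∷ ts)) + k * count U ≤ count D * count U
    shrinks = begin
      count D * count U′ + k * count U        ≤⟨ +-monoʳ-≤ _ (≤-trans incidences≥ (proj₂ (proj₂ best))) ⟩
      count D * count U′ + count D * hits t   ≡⟨ *-distribˡ-+ (count D) _ (hits t) ⟨
      count D * (count U′ + hits t)           ≡⟨ cong (count D *_) (trans (+-comm _ (hits t)) (sym uncovered-split)) ⟩
      count D * count U                       ∎
      where
      open ≤-Reasoning
      U′ = uncovered (t ∷ ts)

  record GreedyState (i : ℕ) : Set where
    field
      chosen        : List (Fin n)
      chosen⊆K      : All (T ∘ K) chosen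
      chosen-length : length chosen ≡ i
      unused-count  : count (unused chosen) + i ≡ count K
      uncovered≤    : count (uncovered chosen) ≤ greedyBound (m ∸ 1) (count K) (count L) i

  initial : GreedyState 0
  initial = record
    { chosen = [] ; chosen⊆K = [] ; chosen-length = refl
    ; unused-count = trans (+-identityʳ _) (count-cong (λ z → ∧-identityʳ (K z)))
    ; uncovered≤ = ≤-reflexive (count-cong (λ z → ∧-identityʳ (L z))) }

  extend : ManyCommonNeighbours → 2 ≤ m → ∀ {i} (s : GreedyState i) →
           0 < count (uncovered (GreedyState.chosen s)) → GreedyState (suc i)
  extend many 2≤m {i} s U>0 = record
    { chosen = t ∷ chosen
    ; chosen⊆K = ∖-elimˡ K (memberOf chosen) t-unused ∷ chosen⊆K
    ; chosen-length = cong suc chosen-length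
    ; unused-count = trans (+-suc _ i) (trans (cong (_+ i) (sym one-fewer)) unused-count)
    ; uncovered≤ = shrink-sound (subst (0 <_) unused≡ unused-nonempty) round uncovered≤ }
    where
    open GreedyState s
    open GreedyRound many 2≤m chosen U>0
    unused≡ : count (unused chosen) ≡ count K ∸ i
    unused≡ = trans (sym (m+n∸n≡m _ i)) (cong (_∸ i) unused-count)
    round : (count K ∸ i) * count (uncovered (t ∷ chosen)) + (m ∸ 1) * count (uncovered chosen)
              ≤ (count K ∸ i) * count (uncovered chosen)
    round rewrite sym unused≡ = shrinks
    remove-t : ∀ z → (unused chosen ∖ (_== t)) z ≡ unused (t ∷ chosen) z
    remove-t z with K z | z == t | memberOf chosen z
    ... | false | _     | _     = refl
    ... | true  | true  | true  = refl
    ... | true  | true  | false = refl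
    ... | true  | false | true  = refl
    ... | true  | false | false = refl
    one-fewer : count (unused chosen) ≡ suc (count (unused (t ∷ chosen)))
    one-fewer = trans (count-remove (unused chosen) t-unused) (cong suc (count-cong remove-t))

  greedy-run : ManyCommonNeighbours → ∀ i → i < m → DominatingStar H m ⊎ GreedyState i
  greedy-run many zero    _     = inj₂ initial
  greedy-run many (suc i) 1+i<m with greedy-run many i (<⇒≤ 1+i<m)
  ... | inj₁ star = inj₁ star
  ... | inj₂ s with 1 ≤? count (uncovered (GreedyState.chosen s))
  ...   | yes U>0 = inj₂ (extend many (≤-trans (s≤s (s≤s z≤n)) 1+i<m) s U>0)
  ...   | no  U≯0 = inj₁ (greedy-star chosen⊆K (begin
    suc (length chosen) + count (uncovered chosen)  ≡⟨ cong₂ (λ l u → suc l + u) chosen-length U≡0 ⟩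
    suc i + 0                                       ≡⟨ +-identityʳ (suc i) ⟩
    suc i                                           ≤⟨ <⇒≤ 1+i<m ⟩
    m                                               ∎))
    where
    open GreedyState s
    open ≤-Reasoning
    U≡0 = n≤0⇒n≡0 (≮⇒≥ U≯0)

  greedy-cover : ManyCommonNeighbours → ∀ {i} → i + greedyBound (m ∸ 1) (count K) (count L) i < m →
                 DominatingStar H m
  greedy-cover many {i} fits with greedy-run many i (≤-trans (s≤s (m≤m+n i _)) fits)
  ... | inj₁ star = star
  ... | inj₂ s    = greedy-star chosen⊆K (begin
    suc (length chosen) + count (uncovered chosen)       ≡⟨ cong (λ l → suc l + _) chosen-length ⟩
    suc i + count (uncovered chosen)                     ≤⟨ +-monoʳ-≤ (suc i) uncovered≤ ⟩
    suc (i + greedyBound (m ∸ 1) (count K) (count L) i)  ≤⟨ fits ⟩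
    m                                                    ∎)
    where
    open GreedyState s
    open ≤-Reasoning

  starCover-at : Settled m (count K) (count L) → StarCover H H′ m
  starCover-at (inj₁ α<m) = inj₂ (single-star α<m)
  starCover-at (inj₂ (i , fits)) with any? (λ w → T? (L w) ×-dec (2 + count (K ∩ adj H w) ≤? m))
  ... | yes (w , Lw , cost) = inj₂ (pair-star Lw cost)
  ... | no  no-cheap-pair   = inj₁ (greedy-cover many {i} fits)
    where
    many : ManyCommonNeighbours
    many {w} Lw = ∸-monoˡ-≤ 1 (≤-pred (≰⇒> (λ cost → no-cheap-pair (w , Lw , cost))))

r≤3⇒2r≤4f⇒r≤1+f : ∀ {r f} → r ≤ 3 → 2 * r ≤ 4 * f → r ≤ suc f
r≤3⇒2r≤4f⇒r≤1+f {0}                       _ _ = z≤n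
r≤3⇒2r≤4f⇒r≤1+f {1}                       _ _ = s≤s z≤n
r≤3⇒2r≤4f⇒r≤1+f {2} {suc f}               _ _ = s≤s (s≤s z≤n)
r≤3⇒2r≤4f⇒r≤1+f {3} {suc (suc f)}         _ _ = s≤s (s≤s (s≤s z≤n))
r≤3⇒2r≤4f⇒r≤1+f {suc (suc (suc (suc _)))} (s≤s (s≤s (s≤s ())))
r≤3⇒2r≤4f⇒r≤1+f {2} {0}                   _ ()
r≤3⇒2r≤4f⇒r≤1+f {3} {0}                   _ ()
r≤3⇒2r≤4f⇒r≤1+f {3} {1}                   _ (s≤s (s≤s (s≤s (s≤s ()))))

module _ {n} {H H′ : Graph n} (compl : Complementary H H′) where

  private
    compl′ : Complementary H′ H
    compl′ = complementary-sym compl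

  neighbourhood-identity : ∀ {u a} → T (adj H u a) →
    count (adj H a) + count (adj H′ u ∩ adj H′ a) ≡ suc (count (adj H a ∩ adj H u) + count (adj H′ u))
  neighbourhood-identity {u} {a} Hua = begin
    count (adj H a) + count D                  ≡⟨ cong (_+ count D) (count-split-member compl (adj H a) u∈) ⟩
    suc (count R + count X) + count D          ≡⟨ cong suc (+-assoc (count R) (count X) (count D)) ⟩
    suc (count R + (count X + count D))        ≡⟨ cong (λ x → suc (count R + (x + count D))) (count-cong X≗) ⟩
    suc (count R + (count X′ + count D))       ≡⟨ cong (λ x → suc (count R + x)) split-at-a ⟨
    suc (count R + count (adj H′ u))           ∎
    where
    open ≡-Reasoning
    D = adj H′ u ∩ adj H′ a
    R = adj H a ∩ adj H u
    X = adj H a ∩ adj H′ u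
    X′ = adj H′ u ∩ adj H a
    X≗ : ∀ z → X z ≡ X′ z
    X≗ z = ∧-comm (adj H a z) (adj H′ u z)
    u∈ = adj-symᵀ H Hua
    split-at-a = count-split-nonmember compl (adj H′ u) (adj⇒non-adj′ compl Hua)

  module _ {u a} (Hua : T (adj H u a)) where

    private
      D R : Fin n → Bool
      D = adj H′ u ∩ adj H′ a
      R = adj H a ∩ adj H u

      toH′ : ∀ {x z} → x ≢ z → ¬ T (adj H x z) → T (adj H′ x z)
      toH′ = non-adj⇒adj′ compl

      toH : ∀ {x z} → x ≢ z → ¬ T (adj H′ x z) → T (adj H x z)
      toH = non-adj⇒adj′ compl′

    triangle-star : ∀ {r} → T (R r) → 3 + count (D ∩ adj H′ r) ≤ 4 → DominatingStar H 4
    triangle-star {r} Rr cost = record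
      { centre = u ; leaves = a ∷ r ∷ [] ; spokes = Hua ∷ ∩-elimʳ (adj H a) (adj H u) Rr ∷ []
      ; undominated = D ∩ adj H′ r
      ; covers = λ { z ((u≢z , ¬Huz) ∷ (a≢z , ¬Haz) ∷ (r≢z , ¬Hrz) ∷ []) →
                     ∩-intro D (adj H′ r) (∩-intro (adj H′ u) (adj H′ a) (toH′ u≢z ¬Huz) (toH′ a≢z ¬Haz))
                                          (toH′ r≢z ¬Hrz) }
      ; cost = cost }

    opposite-star : ∀ {b} → T (D b) → 3 + count (R ∖ adj H′ b) ≤ 4 → DominatingStar H′ 4
    opposite-star {b} Db cost = record
      { centre = b ; leaves = u ∷ a ∷ []
      ; spokes = adj-symᵀ H′ (∩-elimˡ (adj H′ u) (adj H′ a) Db)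
               ∷ adj-symᵀ H′ (∩-elimʳ (adj H′ u) (adj H′ a) Db) ∷ []
      ; undominated = R ∖ adj H′ b
      ; covers = λ { z ((b≢z , ¬H′bz) ∷ (u≢z , ¬H′uz) ∷ (a≢z , ¬H′az) ∷ []) →
                     ∖-intro R (adj H′ b) (∩-intro (adj H a) (adj H u) (toH a≢z ¬H′az) (toH u≢z ¬H′uz)) ¬H′bz }
      ; cost = cost }

    mixed-star : count D ≤ 4 → count R ≤ 3 → StarCover H H′ 4
    mixed-star D≤4 R≤3 with count D ≤? 2
    ... | yes D≤2 = inj₁ (AtVertex.pair-star compl′ 4 u Hua (s≤s (s≤s D≤2)))
    ... | no  D≰2 with any? (λ r → T? (R r) ×-dec (count (D ∩ adj H′ r) ≤? 1))
    ...   | yes (r , Rr , few) = inj₁ (triangle-star Rr (s≤s (s≤s (s≤s few))))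
    ...   | no  none           = inj₂ (opposite-star Db (s≤s (s≤s (s≤s rest≤1))))
      where
      -- Every vertex of R sees two vertices of D in H′, so by double counting some b ∈ D sees
      -- half of R; as |R| ≤ 3, that is all of R but at most one vertex.
      hits : Fin n → ℕ
      hits b = count (R ∩ adj H′ b)
      many : ∀ {r} → T (R r) → 2 ≤ count (D ∩ adj H′ r)
      many {r} Rr = ≰⇒> λ few → none (r , Rr , few)
      best = ∃-above-average D hits (proj₂ (count>0⇒nonempty D (≤-trans (s≤s z≤n) (≰⇒> D≰2))))
      b = proj₁ best
      Db = proj₁ (proj₂ best)
      R≤1+hits : count R ≤ suc (hits b)
      R≤1+hits = r≤3⇒2r≤4f⇒r≤1+f R≤3 (begin
        2 * count R                      ≤⟨ c*count≤∑∈ R (λ r → count (D ∩ adj H′ r)) 2 many ⟩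
        ∑[ r ∈ R ] count (D ∩ adj H′ r)  ≡⟨ ∑∈-count-comm R D (adj H′) (adj-sym H′) ⟩
        ∑[ b ∈ D ] hits b                ≤⟨ proj₂ (proj₂ best) ⟩
        count D * hits b                 ≤⟨ *-monoˡ-≤ (hits b) D≤4 ⟩
        4 * hits b                       ∎)
        where open ≤-Reasoning
      rest≤1 : count (R ∖ adj H′ b) ≤ 1
      rest≤1 = +-cancelˡ-≤ (hits b) _ 1 (begin
        hits b + count (R ∖ adj H′ b)    ≡⟨ count-split R (adj H′ b) ⟨
        count R                          ≤⟨ R≤1+hits ⟩
        suc (hits b)                     ≡⟨ +-comm 1 (hits b) ⟩
        hits b + 1                       ∎)
        where open ≤-Reasoning

module DenseVertex {n} {H H′ : Graph n} (compl : Complementary H H′) (n≤18 : n ≤ 18)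
                   (dense : ∀ w → 8 ≤ count (adj H w) × 8 ≤ count (adj H′ w))
                   {u} (A≡8 : count (adj H u) ≡ 8) where

  private
    compl′ : Complementary H′ H
    compl′ = complementary-sym compl

  A B : Fin n → Bool
  A = adj H u
  B = adj H′ u

  β = count B

  9+β≡n : suc (8 + β) ≡ n
  9+β≡n = trans (cong (λ x → suc (x + β)) (sym A≡8)) (degree-sum compl u)

  degrees : ∀ w → count (adj H w) + count (adj H′ w) ≡ 8 + β
  degrees w = suc-injective (trans (degree-sum compl w) (sym 9+β≡n))

  β≤9 : β ≤ 9
  β≤9 = +-cancelˡ-≤ 8 β 9 (≤-pred (≤-trans (≤-reflexive 9+β≡n) n≤18))

  degree≤β : ∀ w → count (adj H w) ≤ β
  degree≤β w = +-cancelʳ-≤ 8 _ β (≤-trans (+-monoʳ-≤ _ (proj₂ (dense w)))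
                                           (≤-reflexive (trans (degrees w) (+-comm 8 β))))

  degree′≤β : ∀ w → count (adj H′ w) ≤ β
  degree′≤β w = +-cancelˡ-≤ 8 _ β (≤-trans (+-monoˡ-≤ _ (proj₁ (dense w))) (≤-reflexive (degrees w)))

  dense-starCover : StarCover H H′ 4
  dense-starCover
    with any? (λ a → T? (A a) ×-dec (count (B ∩ adj H′ a) ≤? 4))
       | any? (λ b → T? (B b) ×-dec (count (A ∩ adj H b) ≤? 3))
  ... | yes (a , Aa , D≤4) | _ = mixed-star compl Aa D≤4 (≤-pred (+-cancelʳ-≤ β _ 4 (begin
    suc (count (adj H a ∩ A)) + β           ≡⟨ neighbourhood-identity compl Aa ⟨
    count (adj H a) + count (B ∩ adj H′ a)  ≤⟨ +-mono-≤ (degree≤β a) D≤4 ⟩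
    β + 4                                   ≡⟨ +-comm β 4 ⟩
    4 + β                                   ∎)))
    where open ≤-Reasoning
  ... | no _ | yes (b , Bb , D≤3) = swap (mixed-star compl′ Bb (m≤n⇒m≤1+n D≤3) (+-cancelʳ-≤ 9 _ 3 (begin
    count (adj H′ b ∩ B) + 9                ≡⟨ +-suc _ 8 ⟩
    suc (count (adj H′ b ∩ B) + 8)          ≡⟨ cong (λ x → suc (count (adj H′ b ∩ B) + x)) A≡8 ⟨
    suc (count (adj H′ b ∩ B) + count A)    ≡⟨ neighbourhood-identity compl′ Bb ⟨
    count (adj H′ b) + count (A ∩ adj H b)  ≤⟨ +-mono-≤ (≤-trans (degree′≤β b) β≤9) D≤3 ⟩
    3 + 9                                   ∎)))
    where open ≤-Reasoning
  ... | no few-A | no few-B = ⊥-elim (<⇒≱ (m≤m+n 37 3) (begin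
    5 * 8                            ≡⟨ cong (5 *_) A≡8 ⟨
    5 * count A                      ≤⟨ c*count≤∑∈ A (λ a → count (B ∩ adj H′ a)) 5 many-A ⟩
    ∑[ a ∈ A ] count (B ∩ adj H′ a)  ≡⟨ ∑∈-count-comm A B (adj H′) (adj-sym H′) ⟩
    ∑[ b ∈ B ] count (A ∩ adj H′ b)  ≤⟨ ∑∈≤c*count B _ 4 few-B′ ⟩
    4 * β                            ≤⟨ *-monoʳ-≤ 4 β≤9 ⟩
    4 * 9                            ∎))
    where
    open ≤-Reasoning
    many-A : ∀ {a} → T (A a) → 5 ≤ count (B ∩ adj H′ a)
    many-A {a} Aa = ≰⇒> λ few → few-A (a , Aa , few)
    few-B′ : ∀ {b} → T (B b) → count (A ∩ adj H′ b) ≤ 4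
    few-B′ {b} Bb = +-cancelˡ-≤ 4 _ 4 (begin
      4 + count (A ∩ adj H′ b)                    ≤⟨ +-monoˡ-≤ _ (≰⇒> λ few → few-B (b , Bb , few)) ⟩
      count (A ∩ adj H b) + count (A ∩ adj H′ b)  ≡⟨ count-split-nonmember compl A (adj⇒non-adj′ compl′ Bb) ⟨
      count A                                     ≡⟨ A≡8 ⟩
      4 + 4                                       ∎)

certificate-j≥8 : ∀ x l →
  suc (suc (8 + x) * suc (8 + x) * (2 * (8 + x) + 3 * l + 1) + 2 * ((8 + x + l + (8 + x)) * (8 + x + l + (8 + x)))
       + (2 * (x * x * x) + 35 * (x * x) + 5 * (x * x * l) + 172 * x + 66 * (x * l) + 5 * (x * l * l)
          + 158 + 205 * l + 38 * (l * l) + l * l * l))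
  ≡ (8 + x + l) * ((8 + x + l + (8 + x)) * (8 + x + l + (8 + x)))
certificate-j≥8 = solve-∀

certificate-l≥8 : ∀ j y →
  suc (suc j * suc j * (2 * j + 3 * (8 + y) + 1) + 2 * ((j + (8 + y) + j) * (j + (8 + y) + j))
       + (2 * (j * j * j) + 5 * (j * j * y) + 27 * (j * j) + 5 * (j * y * y) + 66 * (j * y) + 204 * j
          + y * y * y + 22 * (y * y) + 157 * y + 358))
  ≡ (j + (8 + y)) * ((j + (8 + y) + j) * (j + (8 + y) + j))
certificate-l≥8 = solve-∀

CubicGap : ℕ → ℕ → Set
CubicGap j l =
  suc j * suc j * (2 * j + 3 * l + 1) + 2 * ((j + l + j) * (j + l + j)) < (j + l) * ((j + l + j) * (j + l + j))

cubicGap? : ∀ j l → Dec (CubicGap j l)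
cubicGap? j l = _ <? _

-- On the cones j ≥ 8 and l ≥ 8 the difference of the two sides is a polynomial with nonnegative
-- coefficients (the certificates above); the finitely many remaining pairs are decided.
cubic-gap : ∀ j l → 8 ≤ j + l → CubicGap j l
cubic-gap j l 8≤j+l with 8 ≤? j | 8 ≤? l
... | yes 8≤j | _ with m≤n⇒∃[o]m+o≡n 8≤j
...   | x , refl = ≤-trans (s≤s (m≤m+n _ _)) (≤-reflexive (certificate-j≥8 x l))
cubic-gap j l 8≤j+l | no _ | yes 8≤l with m≤n⇒∃[o]m+o≡n 8≤l
...   | y , refl = ≤-trans (s≤s (m≤m+n _ _)) (≤-reflexive (certificate-l≥8 j y))
cubic-gap j l 8≤j+l | no j≱8 | no l≱8 = small (≰⇒> j≱8) (≰⇒> l≱8) 8≤j+l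
  where
  small : ∀ {j l} → j < 8 → l < 8 → 8 ≤ j + l → CubicGap j l
  small j<8 = toWitness {a? = allUpTo? (λ j → allUpTo? (λ l → 8 ≤? j + l →-dec cubicGap? j l) 8) 8} _ j<8

m+j+[m+j]≤4m+1⇒j≤m : ∀ m j → (m + j) + (m + j) ≤ 4 * m + 1 → j ≤ m
m+j+[m+j]≤4m+1⇒j≤m m j bound = ≮⇒≥ λ m<j → <⇒≱ (begin-strict
  4 * m + 1                  <⟨ n<1+n (4 * m + 1) ⟩
  suc (4 * m + 1)            ≡⟨ double m ⟩
  (m + suc m) + (m + suc m)  ≤⟨ +-mono-≤ (+-monoʳ-≤ m m<j) (+-monoʳ-≤ m m<j) ⟩
  (m + j) + (m + j)          ∎) bound
  where
  open ≤-Reasoning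
  double : ∀ m → suc (4 * m + 1) ≡ (m + suc m) + (m + suc m)
  double = solve-∀

two-rounds-gap : ∀ m j β → 8 ≤ m → j ≤ m → β + (m + j) ≤ 4 * m + 1 →
                 suc j * suc j * β + 2 * ((m + j) * (m + j)) < m * ((m + j) * (m + j))
two-rounds-gap m j β 8≤m j≤m bound with m≤n⇒∃[o]m+o≡n j≤m
... | l , refl = begin-strict
  suc j * suc j * β + 2 * ((j + l + j) * (j + l + j))                    ≤⟨ +-monoˡ-≤ _ (*-monoʳ-≤ (suc j * suc j) β≤) ⟩
  suc j * suc j * (2 * j + 3 * l + 1) + 2 * ((j + l + j) * (j + l + j))  <⟨ cubic-gap j l 8≤m ⟩
  (j + l) * ((j + l + j) * (j + l + j))                                  ∎
  where
  open ≤-Reasoning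
  split : ∀ j l → 4 * (j + l) + 1 ≡ (2 * j + 3 * l + 1) + (j + l + j)
  split = solve-∀
  β≤ : β ≤ 2 * j + 3 * l + 1
  β≤ = +-cancelʳ-≤ (j + l + j) β _ (≤-trans bound (≤-reflexive (split j l)))

-- With α = m + j, two rounds give α²·u₂ ≤ (j + 1)²·β, and m ≤ 2 + u₂ would contradict the gap.
two-rounds-suffice : ∀ {m α β} → 8 ≤ m → m ≤ α → α ≤ β → β + α ≤ 4 * m + 1 →
                     2 + greedyBound (m ∸ 1) α β 2 < m
two-rounds-suffice {m@(suc k)} {_} {β} 8≤m m≤α α≤β bound with m≤n⇒∃[o]m+o≡n m≤α
... | j , refl = ≰⇒> λ m≤2+u₂ → <⇒≱ (two-rounds-gap m j β 8≤m j≤m bound) (begin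
  m * (α * α)                      ≤⟨ *-monoˡ-≤ (α * α) m≤2+u₂ ⟩
  (2 + u₂) * (α * α)               ≡⟨ *-distribʳ-+ (α * α) 2 u₂ ⟩
  2 * (α * α) + u₂ * (α * α)       ≤⟨ +-monoʳ-≤ (2 * (α * α)) (≤-trans (≤-reflexive (*-comm u₂ (α * α)))
                                                                        (two-rounds-bound k j β)) ⟩
  2 * (α * α) + suc j * suc j * β  ≡⟨ +-comm (2 * (α * α)) _ ⟩
  suc j * suc j * β + 2 * (α * α)  ∎)
  where
  open ≤-Reasoning
  α = m + j
  u₂ = greedyBound k α β 2
  j≤m : j ≤ m
  j≤m = m+j+[m+j]≤4m+1⇒j≤m m j (≤-trans (+-monoˡ-≤ α α≤β) bound)

-- Decided below for n < 31 and α < 16: three rounds suffice unless n ∈ {17, 18} and α = 8.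
TableEntry : ℕ → ℕ → Set
TableEntry n α =
  15 ≤ n → 2 * α < n → suc n / 4 ≤ α →
  3 + greedyBound (suc n / 4 ∸ 1) α (n ∸ suc α) 3 < suc n / 4 ⊎ (n ≡ 17 ⊎ n ≡ 18) × α ≡ 8

tableEntry? : ∀ n α → Dec (TableEntry n α)
tableEntry? n α =
  15 ≤? n →-dec 2 * α <? n →-dec suc n / 4 ≤? α →-dec
  (_ <? _ ⊎-dec ((n ℕ.≟ 17 ⊎-dec n ℕ.≟ 18) ×-dec α ℕ.≟ 8))

three-rounds-table : ∀ {n α} → n < 31 → α < 16 → TableEntry n α
three-rounds-table n<31 = toWitness {a? = allUpTo? (λ n → allUpTo? (tableEntry? n) 16) 31} _ n<31

n≤4[1+n/4]+2 : ∀ n → n ≤ 4 * (suc n / 4) + 2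
n≤4[1+n/4]+2 n = ≤-pred (begin
  suc n                      ≡⟨ m≡m%n+[m/n]*n (suc n) 4 ⟩
  suc n % 4 + suc n / 4 * 4  ≤⟨ +-monoˡ-≤ _ (≤-pred (m%n<n (suc n) 4)) ⟩
  3 + suc n / 4 * 4          ≡⟨ +-comm 3 _ ⟩
  suc n / 4 * 4 + 3          ≡⟨ cong (_+ 3) (*-comm (suc n / 4) 4) ⟩
  4 * (suc n / 4) + 3        ≡⟨ +-suc (4 * (suc n / 4)) 2 ⟩
  suc (4 * (suc n / 4) + 2)  ∎)
  where open ≤-Reasoning

Exceptional : ℕ → ℕ → ℕ → Set
Exceptional n α β = (n ≡ 17 ⊎ n ≡ 18) × 8 ≤ α × 8 ≤ β

module _ {n α β} (15≤n : 15 ≤ n) (degrees : suc (α + β) ≡ n) where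

  private
    m = suc n / 4

  settled-oriented : α ≤ β → Settled m α β ⊎ Exceptional n α β
  settled-oriented α≤β with α <? m | n ≤? 30
  ... | yes α<m | _        = inj₁ (inj₁ α<m)
  ... | no  α≮m | no  n≰30 = inj₁ (inj₂ (2 , two-rounds-suffice 8≤m (≮⇒≥ α≮m) α≤β β+α≤4m+1))
    where
    8≤m = /-monoˡ-≤ 4 (s≤s (≰⇒> n≰30))
    β+α≤4m+1 : β + α ≤ 4 * m + 1
    β+α≤4m+1 = ≤-pred (≤-trans (≤-reflexive (trans (cong suc (+-comm β α)) degrees))
                               (≤-trans (n≤4[1+n/4]+2 n) (≤-reflexive (+-suc (4 * m) 1))))
  ... | no  α≮m | yes n≤30 with three-rounds-table (s≤s n≤30) α<16 15≤n 2α<n (≮⇒≥ α≮m)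
    where
    2α<n : 2 * α < n
    2α<n = ≤-trans (s≤s (+-monoʳ-≤ α (≤-trans (≤-reflexive (+-identityʳ α)) α≤β))) (≤-reflexive degrees)
    α<16 : α < 16
    α<16 = *-cancelˡ-< 2 α 16 (≤-trans 2α<n (≤-trans n≤30 (m≤n⇒m≤1+n (n≤1+n 30))))
  ...   | inj₁ fits        = inj₁ (inj₂ (3 , subst (λ b → 3 + greedyBound (m ∸ 1) α b 3 < m) β≡ fits))
    where
    β≡ : n ∸ suc α ≡ β
    β≡ = trans (cong (_∸ suc α) (sym degrees)) (m+n∸m≡n α β)
  ...   | inj₂ (n≡ , refl) = inj₂ (n≡ , ≤-refl , α≤β)

settled : ∀ {n α β} → 15 ≤ n → suc (α + β) ≡ n →
          (Settled (suc n / 4) α β ⊎ Settled (suc n / 4) β α) ⊎ Exceptional n α β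
settled {n} {α} {β} 15≤n degrees with ≤-total α β
... | inj₁ α≤β = Sum.map₁ inj₁ (settled-oriented 15≤n degrees α≤β)
... | inj₂ β≤α = Sum.map inj₂ (λ (n≡ , 8≤β , 8≤α) → n≡ , 8≤α , 8≤β)
                   (settled-oriented 15≤n (trans (cong suc (+-comm β α)) degrees) β≤α)

one-is-8 : ∀ {x y} → 8 ≤ x → 8 ≤ y → x + y ≤ 17 → x ≡ 8 ⊎ y ≡ 8
one-is-8 {x} {y} 8≤x 8≤y x+y≤17 with x ℕ.≟ 8
... | yes x≡8 = inj₁ x≡8
... | no  x≢8 = inj₂ (≤-antisym (+-cancelˡ-≤ 9 y 8 (≤-trans (+-monoˡ-≤ y 9≤x) x+y≤17)) 8≤y)
  where 9≤x = ≤∧≢⇒< 8≤x (x≢8 ∘ sym)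

module _ {n} (G : Graph n) where

  private
    compl : Complementary G (complement G)
    compl = complement-complementary G

    d d′ : Fin n → ℕ
    d  v = count (adj G v)
    d′ v = count (adj (complement G) v)

  starCover-at-vertex : ∀ {m} v → Settled m (d v) (d′ v) ⊎ Settled m (d′ v) (d v) →
                        StarCover G (complement G) m
  starCover-at-vertex v (inj₁ settled) = AtVertex.starCover-at compl _ v settled
  starCover-at-vertex v (inj₂ settled) = swap (AtVertex.starCover-at (complementary-sym compl) _ v settled)

  exceptional-starCover : n ≡ 17 ⊎ n ≡ 18 → (∀ v → 8 ≤ d v × 8 ≤ d′ v) → Fin n →
                          StarCover G (complement G) (suc n / 4)
  exceptional-starCover n≡ dense v =
    subst (StarCover G (complement G)) (sym m≡4) (at-v (one-is-8 (proj₁ (dense v)) (proj₂ (dense v)) d+d′≤17))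
    where
    m≡4 : suc n / 4 ≡ 4
    m≡4 = [ cong (λ x → suc x / 4) , cong (λ x → suc x / 4) ] n≡
    n≤18 : n ≤ 18
    n≤18 = [ (λ n≡17 → ≤-trans (≤-reflexive n≡17) (n≤1+n 17)) , ≤-reflexive ] n≡
    d+d′≤17 : d v + d′ v ≤ 17
    d+d′≤17 = ≤-pred (≤-trans (≤-reflexive (degree-sum compl v)) n≤18)
    at-v : d v ≡ 8 ⊎ d′ v ≡ 8 → StarCover G (complement G) 4
    at-v (inj₁ d≡8)  = DenseVertex.dense-starCover compl n≤18 dense d≡8
    at-v (inj₂ d′≡8) = swap (DenseVertex.dense-starCover (complementary-sym compl) n≤18
                                                         (Product.swap ∘ dense) d′≡8)

  starCover : 15 ≤ n → StarCover G (complement G) (suc n / 4)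
  starCover 15≤n with all? (λ v → 8 ≤? d v ×-dec 8 ≤? d′ v)
  ... | no sparse-somewhere =
    let v , sparse = ¬∀⟶∃¬ n _ (λ v → 8 ≤? d v ×-dec 8 ≤? d′ v) sparse-somewhere
    in  [ starCover-at-vertex v , ⊥-elim ∘ sparse ∘ proj₂ ] (settled 15≤n (degree-sum compl v))
  ... | yes dense =
    let v = fromℕ< (≤-trans (s≤s z≤n) 15≤n)
    in  [ starCover-at-vertex v , (λ e → exceptional-starCover (proj₁ e) dense v) ]
          (settled 15≤n (degree-sum compl v))

theorem24 : (n : ℕ) → 15 ≤ n → fProperty n (n ∸ (suc n / 4))
theorem24 n 15≤n G = Sum.map dominatingStar⇒minor dominatingStar⇒minor (starCover G 15≤n)
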